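{- Let $s\ge 3$, $n=2^s$, and let $L_s$ be the latin square of order $n$ whose cell $(x,y)$ contains $x\oplus y$ (bitwise exclusive-or). Let $(i,j;k),(i,j';k')\in L_s$ with $i,j,j'\equiv 0\pmod 4$, $0\le i<n/2$ and $0\le j<n/2\le j'<n$. Then there exists an integer $i'\equiv 0\pmod 4$ with $n/2\le i'<n$ such that $$\mathcal{Q}^4_{i,j}(L_s)\cup\mathcal{Q}^4_{i,j'}(L_s)\cup\mathcal{Q}^4_{i',j}(L_s)\cup\mathcal{Q}^4_{i',j'}(L_s)\approx L_3.$$
   Context: Latin squares are identified with sets of triples $(r,c;e)$ meaning symbol $e$ is in cell $(r,c)$. For a partial latin square $P$, $\mathcal{Q}^k_{i,j}(P)=\{(x,y;z)\in P\mid i\le x<i+k,\ j\le y<j+k\}$. $L_3$ is the latin square of order $8$ whose cell $(x,y)$, $x,y\in\{0,\ldots,7\}$, contains $x\oplus y$. Two partial latin squares $P$ and $Q$ are similar, written $P\approx Q$, if there are bijections $\alpha,\beta,\gamma$ between their row index sets, column index sets and symbol sets respectively, with $\alpha$ and $\beta$ monotone (order preserving), such that $P=\{(\alpha r,\beta c;\gamma e)\mid (r,c;e)\in Q\}$. -}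

module Defs where

open import Data.Nat using (ℕ; zero; suc; _+_; _*_; _^_; _≤_; _<_)
open import Data.Nat.DivMod using (_/_; _%_)
open import Data.Product using (_×_; Σ; ∃-syntax)
open import Data.Sum using (_⊎_)
open import Relation.Binary.PropositionalEquality using (_≡_)

-- bitwise exclusive-or on ℕ, by recursion on binary digits.
-- The fuel argument (m + n) is always at least the number of binary digits needed.
xorBit : ℕ → ℕ → ℕ
xorBit zero zero = 0
xorBit zero (suc _) = 1
xorBit (suc _) zero = 1
xorBit (suc _) (suc _) = 0

xorAux : ℕ → ℕ → ℕ → ℕ
xorAux zero m n = 0
xorAux (suc f) m n = xorBit (m % 2) (n % 2) + 2 * xorAux f (m / 2) (n / 2)

_⊕_ : ℕ → ℕ → ℕ
m ⊕ n = xorAux (m + n) m n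

-- A (partial) latin square as a set of triples (r , c ; e), i.e. a predicate on ℕ³.
PLS : Set₁
PLS = ℕ → ℕ → ℕ → Set

L : ℕ → PLS
L s x y z = x < 2 ^ s × y < 2 ^ s × z ≡ x ⊕ y

𝒬 : ℕ → ℕ → ℕ → PLS → PLS
𝒬 k i j P x y z = P x y z × (i ≤ x × x < i + k) × (j ≤ y × y < j + k)

_∪_ : PLS → PLS → PLS
(P ∪ Q) x y z = P x y z ⊎ Q x y z

infixl 5 _∪_

Rows Cols Syms : PLS → ℕ → Set
Rows P r = ∃[ c ] ∃[ e ] P r c e
Cols P c = ∃[ r ] ∃[ e ] P r c e
Syms P e = ∃[ r ] ∃[ c ] P r c e

-- Surjectivity onto the index sets of P follows from the set equality; injectivity
-- of α, β follows from strict monotonicity; injectivity of γ is required explicitly.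
record _≈_ (P Q : PLS) : Set where
  field
    α β γ : ℕ → ℕ
    α-mono : ∀ r r' → Rows Q r → Rows Q r' → r < r' → α r < α r'
    β-mono : ∀ c c' → Cols Q c → Cols Q c' → c < c' → β c < β c'
    γ-inj  : ∀ e e' → Syms Q e → Syms Q e' → γ e ≡ γ e' → e ≡ e'
    image⊆ : ∀ r c e → Q r c e → P (α r) (β c) (γ e)
    ⊆image : ∀ x y z → P x y z →
             ∃[ r ] ∃[ c ] ∃[ e ] (Q r c e × x ≡ α r × y ≡ β c × z ≡ γ e)

{-# OPTIONS --safe #-}
module Submission where

-- Write i = 4a, j = 4b, j' = 4b' and 2^s = 8M, so that a, b < M ≤ b' < 2M, and take
-- i' = 4a' with a' = a ⊕ b ⊕ b'; the top bit of b' gives M ≤ a' < 2M. For l, m < K = 2^k,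
-- xor acts digitwise: (l + hK) ⊕ (m + gK) = l ⊕ m + (h ⊕ g)K. Hence the K × K block of L_s
-- in block position (x, y) is a copy of L_k in symbol block x ⊕ y. Since a ⊕ b = a' ⊕ b'
-- and a ⊕ b' = a' ⊕ b, the four chosen blocks use the symbol blocks a ⊕ b and a ⊕ b' in the
-- pattern of L_1, so the maps sending the lower/upper half of [0, 2K) to the first/second
-- block (rows to a, a'; columns to b, b'; symbols to a ⊕ b, a ⊕ b') carry L_(k+1) onto their
-- union. They are monotone on rows and columns because a < a' and b < b'.

open import Defs
open import Data.Nat using (ℕ; _^_; _≤_; _<_; _/_)
open import Data.Nat.Divisibility using (_∣_)
open import Data.Product using (_×_; ∃-syntax)

open import Data.Nat using (zero; suc; _+_; _*_; _∸_; NonZero; z≤n; s≤s; s≤s⁻¹; z<s; s<s)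
open import Data.Nat.Properties
open import Data.Nat.DivMod
open import Data.Nat.Divisibility using (divides; n∣m*n)
open import Data.Nat.Tactic.RingSolver using (solve-∀)
open import Data.Product using (_,_)
open import Data.Sum using (inj₁; inj₂)
open import Relation.Binary.PropositionalEquality
open import Relation.Nullary using (contradiction)

%-/-injective : ∀ {m n d} .{{_ : NonZero d}} → m % d ≡ n % d → m / d ≡ n / d → m ≡ n
%-/-injective {m} {n} {d} m%d≡n%d m/d≡n/d = begin
  m                 ≡⟨ m≡m%n+[m/n]*n m d ⟩
  m % d + m / d * d ≡⟨ cong₂ (λ r q → r + q * d) m%d≡n%d m/d≡n/d ⟩
  n % d + n / d * d ≡⟨ m≡m%n+[m/n]*n n d ⟨
  n                 ∎
  where open ≡-Reasoning

[m+kn]/n≡m/n+k : ∀ m k n .{{_ : NonZero n}} → (m + k * n) / n ≡ m / n + k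
[m+kn]/n≡m/n+k m k n = trans (+-distrib-/-∣ʳ m (n∣m*n k)) (cong (m / n +_) (m*n/n≡m k n))

[r+qd]%d≡r : ∀ {r} q {d} .{{_ : NonZero d}} → r < d → (r + q * d) % d ≡ r
[r+qd]%d≡r {r} q {d} r<d = trans ([m+kn]%n≡m%n r q d) (m<n⇒m%n≡m r<d)

[r+qd]/d≡q : ∀ {r} q {d} .{{_ : NonZero d}} → r < d → (r + q * d) / d ≡ q
[r+qd]/d≡q {r} q {d} r<d = trans ([m+kn]/n≡m/n+k r q d) (cong (_+ q) (m<n⇒m/n≡0 r<d))

digits-injective : ∀ {r r' q q' d} .{{_ : NonZero d}} → r < d → r' < d →
                   r + q * d ≡ r' + q' * d → r ≡ r' × q ≡ q'
digits-injective {q = q} {q'} {d} r<d r'<d eq =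
  trans (sym ([r+qd]%d≡r q r<d)) (trans (cong (_% d) eq) ([r+qd]%d≡r q' r'<d)) ,
  trans (sym ([r+qd]/d≡q q r<d)) (trans (cong (_/ d) eq) ([r+qd]/d≡q q' r'<d))

lex-< : ∀ {r r' q q' d} → r < d → q < q' → r + q * d < r' + q' * d
lex-< {r} {r'} {q} {q'} {d} r<d q<q' = begin-strict
  r + q * d   <⟨ +-monoˡ-< (q * d) r<d ⟩
  suc q * d   ≤⟨ *-monoˡ-≤ d q<q' ⟩
  q' * d      ≤⟨ m≤n+m (q' * d) r' ⟩
  r' + q' * d ∎
  where open ≤-Reasoning

digits-< : ∀ {r q d n} → r < d → q < n → r + q * d < n * d
digits-< = lex-< {r' = 0}

half< : ∀ t {x} → x < 2 ^ suc t → x / 2 < 2 ^ t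
half< t {x} x< = m<n*o⇒m/o<n (subst (x <_) (*-comm 2 (2 ^ t)) x<)

n<2^n : ∀ n → n < 2 ^ n
n<2^n zero    = z<s
n<2^n (suc n) = +-mono-≤ (m^n>0 2 n) (≤-trans (n<2^n n) (m≤m+n (2 ^ n) 0))

xorBit<2 : ∀ p q → xorBit p q < 2
xorBit<2 zero    zero    = z<s
xorBit<2 zero    (suc _) = s<s z<s
xorBit<2 (suc _) zero    = s<s z<s
xorBit<2 (suc _) (suc _) = z<s

xorBit-comm : ∀ p q → xorBit p q ≡ xorBit q p
xorBit-comm zero    zero    = refl
xorBit-comm zero    (suc _) = refl
xorBit-comm (suc _) zero    = refl
xorBit-comm (suc _) (suc _) = refl

xorBit-assoc : ∀ p q r → xorBit (xorBit p q) r ≡ xorBit p (xorBit q r)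
xorBit-assoc zero    zero    zero    = refl
xorBit-assoc zero    zero    (suc _) = refl
xorBit-assoc zero    (suc _) zero    = refl
xorBit-assoc zero    (suc _) (suc _) = refl
xorBit-assoc (suc _) zero    zero    = refl
xorBit-assoc (suc _) zero    (suc _) = refl
xorBit-assoc (suc _) (suc _) zero    = refl
xorBit-assoc (suc _) (suc _) (suc _) = refl

xorBit-cancelʳ : ∀ {p} q → p < 2 → xorBit (xorBit p q) q ≡ p
xorBit-cancelʳ zero    z<s       = refl
xorBit-cancelʳ (suc _) z<s       = refl
xorBit-cancelʳ zero    (s<s z<s) = refl
xorBit-cancelʳ (suc _) (s<s z<s) = refl

half-sum≤ : ∀ m n {f} → m + n ≤ suc f → m / 2 + n / 2 ≤ f
half-sum≤ m n {f} m+n≤1+f = s≤s⁻¹ (*-cancelʳ-< 2 _ _ (begin-strict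
  (m / 2 + n / 2) * 2   ≡⟨ *-distribʳ-+ 2 (m / 2) (n / 2) ⟩
  m / 2 * 2 + n / 2 * 2 ≤⟨ +-mono-≤ (m/n*n≤m m 2) (m/n*n≤m n 2) ⟩
  m + n                 ≤⟨ m+n≤1+f ⟩
  suc f                 <⟨ m<m*n (suc f) 2 (s<s z<s) ⟩
  suc f * 2             ∎))
  where open ≤-Reasoning

xorAux-zero : ∀ f → xorAux f 0 0 ≡ 0
xorAux-zero zero    = refl
xorAux-zero (suc f) = cong (2 *_) (xorAux-zero f)

xorAux-fuel : ∀ f g {m n} → m + n ≤ f → m + n ≤ g → xorAux f m n ≡ xorAux g m n
xorAux-fuel zero    g       {zero} {zero} _ _ = sym (xorAux-zero g)
xorAux-fuel (suc f) zero    {zero} {zero} _ _ = xorAux-zero (suc f)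
xorAux-fuel (suc f) (suc g) {m} {n} m+n≤f m+n≤g =
  cong (λ x → xorBit (m % 2) (n % 2) + 2 * x)
       (xorAux-fuel f g (half-sum≤ m n m+n≤f) (half-sum≤ m n m+n≤g))

xorAux-unfold : ∀ f m n → m + n ≤ suc f →
                xorAux (suc f) m n ≡ xorBit (m % 2) (n % 2) + ((m / 2) ⊕ (n / 2)) * 2
xorAux-unfold f m n m+n≤1+f = cong (xorBit (m % 2) (n % 2) +_) (begin
  2 * xorAux f (m / 2) (n / 2) ≡⟨ *-comm 2 (xorAux f (m / 2) (n / 2)) ⟩
  xorAux f (m / 2) (n / 2) * 2 ≡⟨ cong (_* 2) (xorAux-fuel f _ (half-sum≤ m n m+n≤1+f) ≤-refl) ⟩
  ((m / 2) ⊕ (n / 2)) * 2      ∎)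
  where open ≡-Reasoning

⊕-unfold : ∀ m n → m ⊕ n ≡ xorBit (m % 2) (n % 2) + ((m / 2) ⊕ (n / 2)) * 2
⊕-unfold zero    zero    = refl
⊕-unfold zero    (suc n) = xorAux-unfold n zero (suc n) ≤-refl
⊕-unfold (suc m) n       = xorAux-unfold (m + n) (suc m) n ≤-refl

⊕-%2 : ∀ m n → (m ⊕ n) % 2 ≡ xorBit (m % 2) (n % 2)
⊕-%2 m n = trans (cong (_% 2) (⊕-unfold m n))
                 ([r+qd]%d≡r ((m / 2) ⊕ (n / 2)) (xorBit<2 (m % 2) (n % 2)))

⊕-/2 : ∀ m n → (m ⊕ n) / 2 ≡ (m / 2) ⊕ (n / 2)
⊕-/2 m n = trans (cong (_/ 2) (⊕-unfold m n))
                 ([r+qd]/d≡q ((m / 2) ⊕ (n / 2)) (xorBit<2 (m % 2) (n % 2)))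

⊕-< : ∀ t {x y} → x < 2 ^ t → y < 2 ^ t → x ⊕ y < 2 ^ t
⊕-< zero    z<s z<s = z<s
⊕-< (suc t) {x} {y} x< y< = begin-strict
  x ⊕ y
    ≡⟨ ⊕-unfold x y ⟩
  xorBit (x % 2) (y % 2) + ((x / 2) ⊕ (y / 2)) * 2
    <⟨ digits-< (xorBit<2 (x % 2) (y % 2)) (⊕-< t (half< t x<) (half< t y<)) ⟩
  2 ^ t * 2
    ≡⟨ *-comm (2 ^ t) 2 ⟩
  2 ^ suc t ∎
  where open ≤-Reasoning

xorAux-comm : ∀ f m n → xorAux f m n ≡ xorAux f n m
xorAux-comm zero    m n = refl
xorAux-comm (suc f) m n =
  cong₂ (λ p x → p + 2 * x) (xorBit-comm (m % 2) (n % 2)) (xorAux-comm f (m / 2) (n / 2))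

⊕-comm : ∀ m n → m ⊕ n ≡ n ⊕ m
⊕-comm m n = trans (xorAux-comm (m + n) m n) (cong (λ f → xorAux f n m) (+-comm m n))

⊕-assoc-bounded : ∀ t {x y z} → x < 2 ^ t → y < 2 ^ t → z < 2 ^ t →
                  (x ⊕ y) ⊕ z ≡ x ⊕ (y ⊕ z)
⊕-assoc-bounded zero    z<s z<s z<s = refl
⊕-assoc-bounded (suc t) {x} {y} {z} x< y< z< = %-/-injective
  (begin
    ((x ⊕ y) ⊕ z) % 2                       ≡⟨ ⊕-%2 (x ⊕ y) z ⟩
    xorBit ((x ⊕ y) % 2) (z % 2)            ≡⟨ cong (λ p → xorBit p (z % 2)) (⊕-%2 x y) ⟩
    xorBit (xorBit (x % 2) (y % 2)) (z % 2) ≡⟨ xorBit-assoc (x % 2) (y % 2) (z % 2) ⟩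
    xorBit (x % 2) (xorBit (y % 2) (z % 2)) ≡⟨ cong (xorBit (x % 2)) (⊕-%2 y z) ⟨
    xorBit (x % 2) ((y ⊕ z) % 2)            ≡⟨ ⊕-%2 x (y ⊕ z) ⟨
    (x ⊕ (y ⊕ z)) % 2                       ∎)
  (begin
    ((x ⊕ y) ⊕ z) / 2                       ≡⟨ ⊕-/2 (x ⊕ y) z ⟩
    ((x ⊕ y) / 2) ⊕ (z / 2)                 ≡⟨ cong (_⊕ (z / 2)) (⊕-/2 x y) ⟩
    ((x / 2) ⊕ (y / 2)) ⊕ (z / 2)           ≡⟨ ⊕-assoc-bounded t (half< t x<) (half< t y<) (half< t z<) ⟩
    (x / 2) ⊕ ((y / 2) ⊕ (z / 2))           ≡⟨ cong ((x / 2) ⊕_) (⊕-/2 y z) ⟨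
    (x / 2) ⊕ ((y ⊕ z) / 2)                 ≡⟨ ⊕-/2 x (y ⊕ z) ⟨
    (x ⊕ (y ⊕ z)) / 2                       ∎)
  where open ≡-Reasoning

[x⊕y]⊕y≡x-bounded : ∀ t {x y} → x < 2 ^ t → y < 2 ^ t → (x ⊕ y) ⊕ y ≡ x
[x⊕y]⊕y≡x-bounded zero    z<s z<s = refl
[x⊕y]⊕y≡x-bounded (suc t) {x} {y} x< y< = %-/-injective
  (begin
    ((x ⊕ y) ⊕ y) % 2                       ≡⟨ ⊕-%2 (x ⊕ y) y ⟩
    xorBit ((x ⊕ y) % 2) (y % 2)            ≡⟨ cong (λ p → xorBit p (y % 2)) (⊕-%2 x y) ⟩
    xorBit (xorBit (x % 2) (y % 2)) (y % 2) ≡⟨ xorBit-cancelʳ (y % 2) (m%n<n x 2) ⟩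
    x % 2                                   ∎)
  (begin
    ((x ⊕ y) ⊕ y) / 2                       ≡⟨ ⊕-/2 (x ⊕ y) y ⟩
    ((x ⊕ y) / 2) ⊕ (y / 2)                 ≡⟨ cong (_⊕ (y / 2)) (⊕-/2 x y) ⟩
    ((x / 2) ⊕ (y / 2)) ⊕ (y / 2)           ≡⟨ [x⊕y]⊕y≡x-bounded t (half< t x<) (half< t y<) ⟩
    x / 2                                   ∎)
  where open ≡-Reasoning

⊕-assoc : ∀ x y z → (x ⊕ y) ⊕ z ≡ x ⊕ (y ⊕ z)
⊕-assoc x y z = ⊕-assoc-bounded (x + y + z)
  (bounded (≤-trans (m≤m+n x y) (m≤m+n (x + y) z)))
  (bounded (≤-trans (m≤n+m y x) (m≤m+n (x + y) z)))
  (bounded (m≤n+m z (x + y)))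
  where
  bounded : ∀ {m} → m ≤ x + y + z → m < 2 ^ (x + y + z)
  bounded m≤ = ≤-<-trans m≤ (n<2^n (x + y + z))

[x⊕y]⊕y≡x : ∀ x y → (x ⊕ y) ⊕ y ≡ x
[x⊕y]⊕y≡x x y = [x⊕y]⊕y≡x-bounded (x + y)
  (≤-<-trans (m≤m+n x y) (n<2^n (x + y)))
  (≤-<-trans (m≤n+m y x) (n<2^n (x + y)))

⊕-cancelˡ : ∀ x {y z} → x ⊕ y ≡ x ⊕ z → y ≡ z
⊕-cancelˡ x {y} {z} x⊕y≡x⊕z = begin
  y             ≡⟨ [x⊕y]⊕y≡x y x ⟨
  (y ⊕ x) ⊕ x   ≡⟨ cong (_⊕ x) (trans (⊕-comm y x) (trans x⊕y≡x⊕z (⊕-comm x z))) ⟩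
  (z ⊕ x) ⊕ x   ≡⟨ [x⊕y]⊕y≡x z x ⟩
  z             ∎
  where open ≡-Reasoning

⊕-exchange : ∀ {x y z w} → x ⊕ y ≡ z ⊕ w → x ⊕ w ≡ z ⊕ y
⊕-exchange {x} {y} {z} {w} x⊕y≡z⊕w = begin
  x ⊕ w               ≡⟨ cong (_⊕ w) ([x⊕y]⊕y≡x x y) ⟨
  ((x ⊕ y) ⊕ y) ⊕ w   ≡⟨ ⊕-assoc (x ⊕ y) y w ⟩
  (x ⊕ y) ⊕ (y ⊕ w)   ≡⟨ cong₂ _⊕_ x⊕y≡z⊕w (⊕-comm y w) ⟩
  (z ⊕ w) ⊕ (w ⊕ y)   ≡⟨ ⊕-assoc (z ⊕ w) w y ⟨
  ((z ⊕ w) ⊕ w) ⊕ y   ≡⟨ cong (_⊕ y) ([x⊕y]⊕y≡x z w) ⟩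
  z ⊕ y               ∎
  where open ≡-Reasoning

*2^suc : ∀ a t → a * 2 ^ suc t ≡ a * 2 ^ t * 2
*2^suc a t = trans (cong (a *_) (*-comm 2 (2 ^ t))) (sym (*-assoc a (2 ^ t) 2))

⊕-digits : ∀ t {m n} a b → m < 2 ^ t → n < 2 ^ t →
           (m + a * 2 ^ t) ⊕ (n + b * 2 ^ t) ≡ m ⊕ n + (a ⊕ b) * 2 ^ t
⊕-digits zero    a b z<s z<s =
  trans (cong₂ _⊕_ (*-identityʳ a) (*-identityʳ b)) (sym (*-identityʳ (a ⊕ b)))
⊕-digits (suc t) {m} {n} a b m< n< = %-/-injective
  (begin
    ((m + a * 2 ^ suc t) ⊕ (n + b * 2 ^ suc t)) % 2
      ≡⟨ ⊕-%2 (m + a * 2 ^ suc t) _ ⟩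
    xorBit ((m + a * 2 ^ suc t) % 2) ((n + b * 2 ^ suc t) % 2)
      ≡⟨ cong₂ xorBit (low% m a) (low% n b) ⟩
    xorBit (m % 2) (n % 2)
      ≡⟨ ⊕-%2 m n ⟨
    (m ⊕ n) % 2
      ≡⟨ low% (m ⊕ n) (a ⊕ b) ⟨
    (m ⊕ n + (a ⊕ b) * 2 ^ suc t) % 2 ∎)
  (begin
    ((m + a * 2 ^ suc t) ⊕ (n + b * 2 ^ suc t)) / 2
      ≡⟨ ⊕-/2 (m + a * 2 ^ suc t) _ ⟩
    ((m + a * 2 ^ suc t) / 2) ⊕ ((n + b * 2 ^ suc t) / 2)
      ≡⟨ cong₂ _⊕_ (high/ m a) (high/ n b) ⟩
    (m / 2 + a * 2 ^ t) ⊕ (n / 2 + b * 2 ^ t)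
      ≡⟨ ⊕-digits t a b (half< t m<) (half< t n<) ⟩
    (m / 2) ⊕ (n / 2) + (a ⊕ b) * 2 ^ t
      ≡⟨ cong (_+ (a ⊕ b) * 2 ^ t) (⊕-/2 m n) ⟨
    (m ⊕ n) / 2 + (a ⊕ b) * 2 ^ t
      ≡⟨ high/ (m ⊕ n) (a ⊕ b) ⟨
    (m ⊕ n + (a ⊕ b) * 2 ^ suc t) / 2 ∎)
  where
  open ≡-Reasoning
  low% : ∀ x c → (x + c * 2 ^ suc t) % 2 ≡ x % 2
  low% x c = trans (cong (λ y → (x + y) % 2) (*2^suc c t)) ([m+kn]%n≡m%n x (c * 2 ^ t) 2)
  high/ : ∀ x c → (x + c * 2 ^ suc t) / 2 ≡ x / 2 + c * 2 ^ t
  high/ x c = trans (cong (λ y → (x + y) / 2) (*2^suc c t)) ([m+kn]/n≡m/n+k x (c * 2 ^ t) 2)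

⊕-+2^ : ∀ t {x y} → x < 2 ^ t → y < 2 ^ t → x ⊕ (y + 2 ^ t) ≡ x ⊕ y + 2 ^ t
⊕-+2^ t {x} {y} x< y< = begin
  x ⊕ (y + 2 ^ t)
    ≡⟨ cong₂ (λ p q → p ⊕ (y + q)) (+-identityʳ x) (*-identityˡ (2 ^ t)) ⟨
  (x + 0 * 2 ^ t) ⊕ (y + 1 * 2 ^ t)
    ≡⟨ ⊕-digits t 0 1 x< y< ⟩
  x ⊕ y + 1 * 2 ^ t
    ≡⟨ cong (x ⊕ y +_) (*-identityˡ (2 ^ t)) ⟩
  x ⊕ y + 2 ^ t ∎
  where open ≡-Reasoning

⊕-≥2^ : ∀ t {x y} → x < 2 ^ t → 2 ^ t ≤ y → y < 2 ^ suc t → 2 ^ t ≤ x ⊕ y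
⊕-≥2^ t {x} {y} x< 2^t≤y y< = begin
  2 ^ t           ≤⟨ m≤n+m (2 ^ t) (x ⊕ w) ⟩
  x ⊕ w + 2 ^ t   ≡⟨ ⊕-+2^ t x< w< ⟨
  x ⊕ (w + 2 ^ t) ≡⟨ cong (x ⊕_) (m∸n+n≡m 2^t≤y) ⟩
  x ⊕ y           ∎
  where
  open ≤-Reasoning
  w : ℕ
  w = y ∸ 2 ^ t
  w< : w < 2 ^ t
  w< = m<n+o⇒m∸n<o y (2 ^ t) {{m^n≢0 2 t}} (subst (y <_) (cong (2 ^ t +_) (+-identityʳ (2 ^ t))) y<)

select : ℕ → ℕ → ℕ → ℕ
select x x' zero    = x
select x x' (suc _) = x'

select-injective : ∀ {x x' h h'} → x ≢ x' → h < 2 → h' < 2 →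
                   select x x' h ≡ select x x' h' → h ≡ h'
select-injective x≢x' z<s       z<s       _  = refl
select-injective x≢x' (s<s z<s) (s<s z<s) _  = refl
select-injective x≢x' z<s       (s<s z<s) eq = contradiction eq x≢x'
select-injective x≢x' (s<s z<s) z<s       eq = contradiction (sym eq) x≢x'

select-⊕ : ∀ {a a' b b' h g} → a ⊕ b ≡ a' ⊕ b' → h < 2 → g < 2 →
           select (a ⊕ b) (a ⊕ b') (h ⊕ g) ≡ select a a' h ⊕ select b b' g
select-⊕ a⊕b≡a'⊕b' z<s       z<s       = refl
select-⊕ a⊕b≡a'⊕b' z<s       (s<s z<s) = refl
select-⊕ {a} {a'} {b} {b'} a⊕b≡a'⊕b' (s<s z<s) z<s = ⊕-exchange {a} {b} {a'} {b'} a⊕b≡a'⊕b'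
select-⊕ a⊕b≡a'⊕b' (s<s z<s) (s<s z<s) = a⊕b≡a'⊕b'

data Halves (K : ℕ) : ℕ → Set where
  digits : ∀ {l h} → l < K → h < 2 → Halves K (l + h * K)

halves : ∀ {K r} .{{_ : NonZero K}} → r < 2 * K → Halves K r
halves {K} {r} r< = subst (Halves K) (sym (m≡m%n+[m/n]*n r K)) (digits (m%n<n r K) (m<n*o⇒m/o<n r<))

Halves-< : ∀ {K r} → Halves K r → r < 2 * K
Halves-< (digits l< h<) = digits-< l< h<

place : (K : ℕ) .{{_ : NonZero K}} → ℕ → ℕ → ℕ → ℕ
place K x x' r = r % K + select x x' (r / K) * K

place-digits : ∀ {K} .{{_ : NonZero K}} x x' {l} h → l < K →
               place K x x' (l + h * K) ≡ l + select x x' h * K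
place-digits {K} x x' h l< =
  cong₂ (λ r q → r + select x x' q * K) ([r+qd]%d≡r h l<) ([r+qd]/d≡q h l<)

place-mono : ∀ {K x x' r r'} .{{_ : NonZero K}} → x < x' → Halves K r → Halves K r' → r < r' →
             place K x x' r < place K x x' r'
place-mono {K} {x} {x'} x<x' (digits {l} {h} l< h<) (digits {l'} {h'} l'< h'<) r<r' =
  subst₂ _<_ (sym (place-digits x x' h l<)) (sym (place-digits x x' h' l'<)) (select-lex h< h'< r<r')
  where
  select-lex : h < 2 → h' < 2 → l + h * K < l' + h' * K →
               l + select x x' h * K < l' + select x x' h' * K
  select-lex z<s       z<s       r<r' = +-monoˡ-< (x * K) (+-cancelʳ-< 0 l l' r<r')
  select-lex (s<s z<s) (s<s z<s) r<r' = +-monoˡ-< (x' * K) (+-cancelʳ-< (1 * K) l l' r<r')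
  select-lex z<s       (s<s z<s) _    = lex-< l< x<x'
  select-lex (s<s z<s) z<s       r<r' = contradiction r<r' (<-asym (lex-< {r' = l} {q' = 1} l'< z<s))

place-injective : ∀ {K x x' r r'} .{{_ : NonZero K}} → x ≢ x' → Halves K r → Halves K r' →
                  place K x x' r ≡ place K x x' r' → r ≡ r'
place-injective {K} {x} {x'} x≢x' (digits {l} {h} l< h<) (digits {l'} {h'} l'< h'<) eq
  with digits-injective l< l'< (trans (sym (place-digits x x' h l<)) (trans eq (place-digits x x' h' l'<)))
... | l≡l' , sel≡sel = cong₂ (λ l h → l + h * K) l≡l' (select-injective x≢x' h< h'< sel≡sel)

place-onto : ∀ {K x x' h y} .{{_ : NonZero K}} → h < 2 →
             select x x' h * K ≤ y × y < select x x' h * K + K →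
             ∃[ r ] (Halves K r × y ≡ place K x x' r)
place-onto {K} {x} {x'} {h} {y} h< (X≤y , y<) =
  l + h * K , digits l< h< , trans (sym (m∸n+n≡m X≤y)) (sym (place-digits x x' h l<))
  where
  l : ℕ
  l = y ∸ select x x' h * K
  l< : l < K
  l< = m<n+o⇒m∸n<o y (select x x' h * K) y<

fourBlocks : ℕ → ℕ → ℕ → ℕ → ℕ → ℕ → PLS
fourBlocks n s i i' j j' = 𝒬 n i j (L s) ∪ 𝒬 n i j' (L s) ∪ 𝒬 n i' j (L s) ∪ 𝒬 n i' j' (L s)

module FourBlocks (k t : ℕ) {a a' b b' : ℕ} (a<a' : a < a') (a'<2^t : a' < 2 ^ t)
                  (b<b' : b < b') (b'<2^t : b' < 2 ^ t) (a⊕b≡a'⊕b' : a ⊕ b ≡ a' ⊕ b') where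

  K : ℕ
  K = 2 ^ k

  instance
    K-nonZero : NonZero K
    K-nonZero = m^n≢0 2 k

  a<2^t : a < 2 ^ t
  a<2^t = <-trans a<a' a'<2^t

  b<2^t : b < 2 ^ t
  b<2^t = <-trans b<b' b'<2^t

  P : PLS
  P = fourBlocks K (k + t) (a * K) (a' * K) (b * K) (b' * K)

  α β γ : ℕ → ℕ
  α = place K a a'
  β = place K b b'
  γ = place K (a ⊕ b) (a ⊕ b')

  γ-hom : ∀ {r c} → Halves K r → Halves K c → γ (r ⊕ c) ≡ α r ⊕ β c
  γ-hom (digits {l} {h} l< h<) (digits {m} {g} m< g<) = begin
    γ ((l + h * K) ⊕ (m + g * K))
      ≡⟨ cong γ (⊕-digits k h g l< m<) ⟩
    γ (l ⊕ m + (h ⊕ g) * K)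
      ≡⟨ place-digits (a ⊕ b) (a ⊕ b') (h ⊕ g) (⊕-< k l< m<) ⟩
    l ⊕ m + select (a ⊕ b) (a ⊕ b') (h ⊕ g) * K
      ≡⟨ cong (λ q → l ⊕ m + q * K) (select-⊕ a⊕b≡a'⊕b' h< g<) ⟩
    l ⊕ m + (select a a' h ⊕ select b b' g) * K
      ≡⟨ ⊕-digits k (select a a' h) (select b b' g) l< m< ⟨
    (l + select a a' h * K) ⊕ (m + select b b' g * K)
      ≡⟨ cong₂ _⊕_ (place-digits a a' h l<) (place-digits b b' g m<) ⟨
    α (l + h * K) ⊕ β (m + g * K) ∎
    where open ≡-Reasoning

  cell : ∀ {x y l m} → x < 2 ^ t → y < 2 ^ t → l < K → m < K →
         𝒬 K (x * K) (y * K) (L (k + t)) (l + x * K) (m + y * K) ((l + x * K) ⊕ (m + y * K))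
  cell {x} {y} x< y< l< m< = (inL x< l< , inL y< m< , refl) , inBlock x l< , inBlock y m<
    where
    inL : ∀ {x l} → x < 2 ^ t → l < K → l + x * K < 2 ^ (k + t)
    inL {x} {l} x< l< =
      subst (l + x * K <_) (trans (*-comm (2 ^ t) K) (sym (^-distribˡ-+-* 2 k t))) (digits-< l< x<)
    inBlock : ∀ x {l} → l < K → x * K ≤ l + x * K × l + x * K < x * K + K
    inBlock x {l} l< = m≤n+m (x * K) l , subst (l + x * K <_) (+-comm K (x * K)) (+-monoˡ-< (x * K) l<)

  cell∈P : ∀ {h g l m} → h < 2 → g < 2 → l < K → m < K →
           let x = l + select a a' h * K ; y = m + select b b' g * K in P x y (x ⊕ y)
  cell∈P z<s       z<s       l< m< = inj₁ (inj₁ (inj₁ (cell a<2^t b<2^t l< m<)))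
  cell∈P z<s       (s<s z<s) l< m< = inj₁ (inj₁ (inj₂ (cell a<2^t b'<2^t l< m<)))
  cell∈P (s<s z<s) z<s       l< m< = inj₁ (inj₂ (cell a'<2^t b<2^t l< m<))
  cell∈P (s<s z<s) (s<s z<s) l< m< = inj₂ (cell a'<2^t b'<2^t l< m<)

  image⊆ : ∀ r c e → L (suc k) r c e → P (α r) (β c) (γ e)
  image⊆ r c e (r< , c< , refl) =
    subst (P (α r) (β c)) (sym (γ-hom (halves r<) (halves c<))) (αβ-cell (halves r<) (halves c<))
    where
    αβ-cell : ∀ {r c} → Halves K r → Halves K c → P (α r) (β c) (α r ⊕ β c)
    αβ-cell (digits {l} {h} l< h<) (digits {m} {g} m< g<) =
      subst₂ (λ x y → P x y (x ⊕ y)) (sym (place-digits a a' h l<)) (sym (place-digits b b' g m<))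
             (cell∈P h< g< l< m<)

  preimage : ∀ {h g x y z} → h < 2 → g < 2 →
             𝒬 K (select a a' h * K) (select b b' g * K) (L (k + t)) x y z →
             ∃[ r ] ∃[ c ] ∃[ e ] (L (suc k) r c e × x ≡ α r × y ≡ β c × z ≡ γ e)
  preimage h< g< ((_ , _ , refl) , x∈ , y∈) with place-onto h< x∈ | place-onto g< y∈
  ... | r , r-halves , x≡αr | c , c-halves , y≡βc =
    r , c , r ⊕ c , (Halves-< r-halves , Halves-< c-halves , refl) , x≡αr , y≡βc ,
    trans (cong₂ _⊕_ x≡αr y≡βc) (sym (γ-hom r-halves c-halves))

  ⊆image : ∀ x y z → P x y z →
           ∃[ r ] ∃[ c ] ∃[ e ] (L (suc k) r c e × x ≡ α r × y ≡ β c × z ≡ γ e)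
  ⊆image x y z (inj₁ (inj₁ (inj₁ x,y,z∈))) = preimage z<s       z<s       x,y,z∈
  ⊆image x y z (inj₁ (inj₁ (inj₂ x,y,z∈))) = preimage z<s       (s<s z<s) x,y,z∈
  ⊆image x y z (inj₁ (inj₂ x,y,z∈))        = preimage (s<s z<s) z<s       x,y,z∈
  ⊆image x y z (inj₂ x,y,z∈)               = preimage (s<s z<s) (s<s z<s) x,y,z∈

  fourBlocks≈L : P ≈ L (suc k)
  fourBlocks≈L = record
    { α = α ; β = β ; γ = γ
    ; α-mono = λ { _ _ (_ , _ , r< , _) (_ , _ , r'< , _) → place-mono a<a' (halves r<) (halves r'<) }
    ; β-mono = λ { _ _ (_ , _ , _ , c< , _) (_ , _ , _ , c'< , _) → place-mono b<b' (halves c<) (halves c'<) }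
    ; γ-inj  = λ { _ _ (_ , _ , r< , c< , refl) (_ , _ , r'< , c'< , refl) →
                   place-injective a⊕b≢a⊕b' (halves (⊕-< (suc k) r< c<)) (halves (⊕-< (suc k) r'< c'<)) }
    ; image⊆ = image⊆
    ; ⊆image = ⊆image
    }
    where
    a⊕b≢a⊕b' : a ⊕ b ≢ a ⊕ b'
    a⊕b≢a⊕b' eq = <-irrefl (⊕-cancelˡ a eq) b<b'

2^[3+u]≡2^[1+u]*4 : ∀ u → 2 ^ (3 + u) ≡ 2 ^ suc u * 4
2^[3+u]≡2^[1+u]*4 u = identity (2 ^ u)
  where
  identity : ∀ p → 2 * (2 * (2 * p)) ≡ 2 * p * 4
  identity = solve-∀

2^[3+u]/2≡2^u*4 : ∀ u → 2 ^ (3 + u) / 2 ≡ 2 ^ u * 4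
2^[3+u]/2≡2^u*4 u = trans (cong (_/ 2) (identity (2 ^ u))) (m*n/n≡m (2 ^ u * 4) 2)
  where
  identity : ∀ p → 2 * (2 * (2 * p)) ≡ p * 4 * 2
  identity = solve-∀

corollary5p6 : ∀ (s : ℕ) → 3 ≤ s →
    ∀ (i j j' k k' : ℕ) → L s i j k → L s i j' k' →
    4 ∣ i → 4 ∣ j → 4 ∣ j' →
    i < 2 ^ s / 2 → j < 2 ^ s / 2 → 2 ^ s / 2 ≤ j' → j' < 2 ^ s →
    ∃[ i' ] (4 ∣ i' × 2 ^ s / 2 ≤ i' × i' < 2 ^ s ×
      (𝒬 4 i j (L s) ∪ 𝒬 4 i j' (L s) ∪ 𝒬 4 i' j (L s) ∪ 𝒬 4 i' j' (L s)) ≈ L 3)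
corollary5p6 _ (s≤s (s≤s (s≤s {n = u} z≤n))) .(a * 4) .(b * 4) .(b' * 4) _ _ _ _
  (divides a refl) (divides b refl) (divides b' refl) i<n/2 j<n/2 n/2≤j' j'<n =
  a' * 4 , divides a' refl , subst (_≤ a' * 4) (sym (2^[3+u]/2≡2^u*4 u)) (*-monoˡ-≤ 4 M≤a') ,
  subst (a' * 4 <_) (sym (2^[3+u]≡2^[1+u]*4 u)) (*-monoˡ-< 4 a'<2M) ,
  FourBlocks.fourBlocks≈L 2 (suc u) (<-≤-trans a<M M≤a') a'<2M (<-≤-trans b<M M≤b') b'<2M
    (sym ([x⊕y]⊕y≡x (a ⊕ b) b'))
  where
  M : ℕ
  M = 2 ^ u
  a<M : a < M
  a<M = *-cancelʳ-< 4 a M (subst (a * 4 <_) (2^[3+u]/2≡2^u*4 u) i<n/2)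
  b<M : b < M
  b<M = *-cancelʳ-< 4 b M (subst (b * 4 <_) (2^[3+u]/2≡2^u*4 u) j<n/2)
  M≤b' : M ≤ b'
  M≤b' = *-cancelʳ-≤ M b' 4 (subst (_≤ b' * 4) (2^[3+u]/2≡2^u*4 u) n/2≤j')
  b'<2M : b' < 2 * M
  b'<2M = *-cancelʳ-< 4 b' (2 * M) (subst (b' * 4 <_) (2^[3+u]≡2^[1+u]*4 u) j'<n)
  a⊕b<M : a ⊕ b < M
  a⊕b<M = ⊕-< u a<M b<M
  a' : ℕ
  a' = (a ⊕ b) ⊕ b'
  M≤a' : M ≤ a'
  M≤a' = ⊕-≥2^ u a⊕b<M M≤b' b'<2M
  a'<2M : a' < 2 * M
  a'<2M = ⊕-< (suc u) (<-trans a⊕b<M (^-monoʳ-< 2 (s<s z<s) (n<1+n u))) b'<2M
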